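{- $(9,2)\in\mathrm{HWP}(24;3,4)$; that is, $K_{24}$ minus a 1-factor has a 2-factorization consisting of exactly $9$ $C_3$-factors and $2$ $C_4$-factors.
   Context: A $C_k$-factor of a graph is a spanning subgraph all of whose components are cycles of length $k$. A 2-factorization is a partition of the edge set into 2-factors. $\mathrm{HWP}(v;m,n)$ is the set of pairs $(\alpha,\beta)$ such that $K_v$ ($v$ odd) or $K_v$ minus a 1-factor ($v$ even) has a 2-factorization into exactly $\alpha$ $C_m$-factors and $\beta$ $C_n$-factors. -}

module Defs where

open import Data.Nat using (ℕ; zero; suc; _≤_; _∸_)
open import Data.Nat.Properties using ()
open import Data.Fin using (Fin; toℕ)
open import Data.Product using (Σ; _×_; _,_)
open import Data.Sum using (_⊎_; inj₁; inj₂)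
open import Relation.Binary.PropositionalEquality using (_≡_)
open import Relation.Nullary using (¬_)
open import Function.Definitions using (Bijective)
open import Data.Nat using (_%_)

record OneFactor (v : ℕ) : Set where
  field
    mate     : Fin v → Fin v
    involut  : ∀ x → mate (mate x) ≡ x
    nofix    : ∀ x → ¬ (mate x ≡ x)

CycSucc : (k : ℕ) → Fin k → Fin k → Set
CycSucc k i j = (toℕ j ≡ suc (toℕ i)) ⊎ ((toℕ i ≡ k ∸ 1) × (toℕ j ≡ 0))

-- Cycle c visits pos (c , 0), pos (c , 1), …, pos (c , k-1) and
-- back; pos is a bijection, so the cycles are vertex-disjoint, each cycle
-- has k distinct vertices, and every vertex is covered.
record CFactor (v k : ℕ) : Set where
  field
    3≤k    : 3 ≤ k
    r      : ℕ
    pos    : Fin r × Fin k → Fin v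
    bij    : Bijective _≡_ _≡_ pos

FEdge : ∀ {v k} → CFactor v k → Fin v → Fin v → Set
FEdge {v} {k} F x y =
  Σ (Fin (CFactor.r F)) λ c → Σ (Fin k) λ i → Σ (Fin k) λ j →
    CycSucc k i j ×
    ((CFactor.pos F (c , i) ≡ x × CFactor.pos F (c , j) ≡ y) ⊎
     (CFactor.pos F (c , i) ≡ y × CFactor.pos F (c , j) ≡ x))

FamEdge : ∀ {v m n α β} → (Fin α → CFactor v m) → (Fin β → CFactor v n) →
          Fin α ⊎ Fin β → Fin v → Fin v → Set
FamEdge mF nF (inj₁ a) = FEdge (mF a)
FamEdge mF nF (inj₂ b) = FEdge (nF b)

record TwoFactorization (v m n α β : ℕ) (E : Fin v → Fin v → Set) : Set where
  field
    mFactor : Fin α → CFactor v m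
    nFactor : Fin β → CFactor v n
    sound   : ∀ f x y → FamEdge mFactor nFactor f x y → E x y
    unique  : ∀ x y → E x y →
              Σ (Fin α ⊎ Fin β) λ f → FamEdge mFactor nFactor f x y ×
                (∀ g → FamEdge mFactor nFactor g x y → g ≡ f)

KEdge : ∀ {v} → Fin v → Fin v → Set
KEdge x y = ¬ (x ≡ y)

KminusIEdge : ∀ {v} → OneFactor v → Fin v → Fin v → Set
KminusIEdge I x y = ¬ (x ≡ y) × ¬ (y ≡ OneFactor.mate I x)

HWP : (v m n α β : ℕ) → Set
HWP v m n α β =
  (v % 2 ≡ 1 × TwoFactorization v m n α β KEdge) ⊎
  (v % 2 ≡ 0 × Σ (OneFactor v) λ I → TwoFactorization v m n α β (KminusIEdge I))

-- Write the 24 vertices as pairs (b , t) with b ∈ Fin 8 and t ∈ ℤ₃, and let the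
-- 1-factor pair (2i , t) with (2i+1 , t).  The nine C₃-factors are the translates
-- under t ↦ t + s of three base C₃-factors, and each C₄-factor is the union of the
-- translates of two base 4-cycles.  These eleven factors partition the edges of
-- K₂₄ minus the 1-factor iff, at every vertex x, their 22 edges at x are exactly
-- the 22 edges of the graph at x, each met once.  This local condition, like the
-- fact that each factor covers every vertex once, is decided by evaluation.

module Submission where

open import Data.Fin using (Fin; combine; remQuot; toℕ; #_)
open import Data.Fin.Properties using (_≟_; all?; any?)
open import Data.Nat using (ℕ; suc; _+_; _∸_; _≤_; s≤s; z≤n)
import Data.Nat.Properties as ℕ
open import Data.Nat.DivMod using (_mod_)
open import Data.Product using (∃; _×_; _,_; proj₁; proj₂; uncurry)
import Data.Product.Properties as Product
open import Data.Sum using (_⊎_; inj₁; inj₂; [_,_])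
import Data.Sum.Properties as Sum
open import Data.Vec using (Vec; []; _∷_; lookup; tabulate)
open import Data.Vec.Properties using (lookup∘tabulate)
open import Function using (_∘_)
open import Function.Definitions using (Bijective)
open import Function.Consequences.Propositional using (strictlySurjective⇒surjective)
open import Relation.Binary.PropositionalEquality using (_≡_; refl; sym; trans; subst)
open import Relation.Nullary using (Dec; ¬?)
open import Relation.Nullary.Decidable using (_×-dec_; _⊎-dec_; _→-dec_; toWitness; fromWitness; map′)
open import Relation.Unary using (Pred; Decidable)
open import Defs

all×? : ∀ {r k p} {P : Pred (Fin r × Fin k) p} → Decidable P → Dec (∀ q → P q)
all×? P? = map′ (λ h (c , i) → h c i) (λ h c i → h (c , i))
                (all? λ c → all? λ i → P? (c , i))

any×? : ∀ {r k p} {P : Pred (Fin r × Fin k) p} → Decidable P → Dec (∃ P)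
any×? P? = map′ (λ (c , i , p) → (c , i) , p) (λ ((c , i) , p) → c , i , p)
                (any? λ c → any? λ i → P? (c , i))

all⊎? : ∀ {m n p} {P : Pred (Fin m ⊎ Fin n) p} → Decidable P → Dec (∀ f → P f)
all⊎? P? = map′ (λ (l , r) → [ l , r ]) (λ h → h ∘ inj₁ , h ∘ inj₂)
                (all? (P? ∘ inj₁) ×-dec all? (P? ∘ inj₂))

any⊎? : ∀ {m n p} {P : Pred (Fin m ⊎ Fin n) p} → Decidable P → Dec (∃ P)
any⊎? P? = map′ [ (λ (a , p) → inj₁ a , p) , (λ (b , p) → inj₂ b , p) ]
                (λ { (inj₁ a , p) → inj₁ (a , p) ; (inj₂ b , p) → inj₂ (b , p) })
                (any? (P? ∘ inj₁) ⊎-dec any? (P? ∘ inj₂))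

module _ {v r k} (pos : Fin r × Fin k → Fin v) where

  injective? : Dec (∀ p q → pos p ≡ pos q → p ≡ q)
  injective? = all×? λ p → all×? λ q → pos p ≟ pos q →-dec Product.≡-dec _≟_ _≟_ p q

  preimage? : ∀ y → Dec (∃ λ p → pos p ≡ y)
  preimage? y = any×? λ p → pos p ≟ y

  -- The preimage of y is taken from the search preimage? y, not from surj: locating
  -- a vertex during the final check then never evaluates the proof of surj.
  bijective : (∀ p q → pos p ≡ pos q → p ≡ q) → (∀ y → ∃ λ p → pos p ≡ y) →
              Bijective _≡_ _≡_ pos
  bijective inj surj =
    (λ {p} {q} → inj p q) ,
    strictlySurjective⇒surjective (λ y → toWitness (fromWitness {a? = preimage? y} (surj y)))

cycleFactor : ∀ {v r k} → 3 ≤ k → (pos : Fin r × Fin k → Fin v) →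
              (∀ p q → pos p ≡ pos q → p ≡ q) → (∀ y → ∃ λ p → pos p ≡ y) → CFactor v k
cycleFactor 3≤k pos inj surj =
  record { 3≤k = 3≤k ; r = _ ; pos = pos ; bij = bijective pos inj surj }

CycSucc? : ∀ k i j → Dec (CycSucc k i j)
CycSucc? k i j = toℕ j ℕ.≟ suc (toℕ i) ⊎-dec (toℕ i ℕ.≟ k ∸ 1 ×-dec toℕ j ℕ.≟ 0)

-- A cycle γ of length k together with the index at which it passes through a
-- distinguished vertex.
PointedCycle : ℕ → ℕ → Set
PointedCycle v k = Fin k × (Fin k → Fin v)

Adjacent : ∀ {v k} → PointedCycle v k → Fin v → Set
Adjacent {k = k} (i , γ) y = ∃ λ j → (CycSucc k i j ⊎ CycSucc k j i) × γ j ≡ y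

adjacent? : ∀ {v k} (C : PointedCycle v k) y → Dec (Adjacent C y)
adjacent? {k = k} (i , γ) y = any? λ j → (CycSucc? k i j ⊎-dec CycSucc? k j i) ×-dec γ j ≟ y

module _ {v k} (F : CFactor v k) where
  open CFactor F

  locate : Fin v → Fin r × Fin k
  locate y = proj₁ (proj₂ bij y)

  pos-locate : ∀ y → pos (locate y) ≡ y
  pos-locate y = proj₂ (proj₂ bij y) refl

  locate-pos : ∀ p {y} → pos p ≡ y → p ≡ locate y
  locate-pos p eq = proj₁ bij (trans eq (sym (pos-locate _)))

  pointAt : Fin r × Fin k → PointedCycle v k
  pointAt (c , i) = i , λ j → pos (c , j)

  cycleThrough : Fin v → PointedCycle v k
  cycleThrough = pointAt ∘ locate

  FEdge⇒Adjacent : ∀ {x y} → FEdge F x y → Adjacent (cycleThrough x) y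
  FEdge⇒Adjacent {y = y} (c , i , j , s , inj₁ (px , py)) =
    subst (λ p → Adjacent (pointAt p) y) (locate-pos (c , i) px) (j , inj₁ s , py)
  FEdge⇒Adjacent {y = y} (c , i , j , s , inj₂ (py , px)) =
    subst (λ p → Adjacent (pointAt p) y) (locate-pos (c , j) px) (i , inj₂ s , py)

  Adjacent⇒FEdge : ∀ {x y} → Adjacent (cycleThrough x) y → FEdge F x y
  Adjacent⇒FEdge {x} (j , inj₁ s , py) = _ , _ , j , s , inj₁ (pos-locate x , py)
  Adjacent⇒FEdge {x} (j , inj₂ s , py) = _ , j , _ , s , inj₂ (py , pos-locate x)

module _ {v m n α β} (mF : Fin α → CFactor v m) (nF : Fin β → CFactor v n) where

  Neighbourhood : Set
  Neighbourhood = Vec (PointedCycle v m) α × Vec (PointedCycle v n) β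

  -- Tabulated, so that each cycle through x is located once per vertex x.
  neighbourhood : Fin v → Neighbourhood
  neighbourhood x =
    tabulate (λ a → cycleThrough (mF a) x) , tabulate (λ b → cycleThrough (nF b) x)

  AdjacentIn : Neighbourhood → Fin α ⊎ Fin β → Fin v → Set
  AdjacentIn (cs , ds) (inj₁ a) = Adjacent (lookup cs a)
  AdjacentIn (cs , ds) (inj₂ b) = Adjacent (lookup ds b)

  adjacentIn? : ∀ N f y → Dec (AdjacentIn N f y)
  adjacentIn? (cs , ds) (inj₁ a) = adjacent? (lookup cs a)
  adjacentIn? (cs , ds) (inj₂ b) = adjacent? (lookup ds b)

  FamEdge⇒AdjacentIn : ∀ f {x y} → FamEdge mF nF f x y → AdjacentIn (neighbourhood x) f y
  FamEdge⇒AdjacentIn (inj₁ a) {y = y} e =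
    subst (λ C → Adjacent C y) (sym (lookup∘tabulate _ a)) (FEdge⇒Adjacent (mF a) e)
  FamEdge⇒AdjacentIn (inj₂ b) {y = y} e =
    subst (λ C → Adjacent C y) (sym (lookup∘tabulate _ b)) (FEdge⇒Adjacent (nF b) e)

  AdjacentIn⇒FamEdge : ∀ f {x y} → AdjacentIn (neighbourhood x) f y → FamEdge mF nF f x y
  AdjacentIn⇒FamEdge (inj₁ a) {y = y} e =
    Adjacent⇒FEdge (mF a) (subst (λ C → Adjacent C y) (lookup∘tabulate _ a) e)
  AdjacentIn⇒FamEdge (inj₂ b) {y = y} e =
    Adjacent⇒FEdge (nF b) (subst (λ C → Adjacent C y) (lookup∘tabulate _ b) e)

  module _ {E : Fin v → Fin v → Set} (E? : ∀ x y → Dec (E x y)) where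

    PartitionsEdgesAt : Fin v → Neighbourhood → Set
    PartitionsEdgesAt x N =
      (∀ f y → AdjacentIn N f y → E x y) ×
      (∀ y → E x y → ∃ λ f → AdjacentIn N f y × ∀ g → AdjacentIn N g y → g ≡ f)

    partitionsEdgesAt? : ∀ x N → Dec (PartitionsEdgesAt x N)
    partitionsEdgesAt? x N =
      (all⊎? λ f → all? λ y → adjacentIn? N f y →-dec E? x y) ×-dec
      (all? λ y → E? x y →-dec any⊎? λ f → adjacentIn? N f y ×-dec
         all⊎? λ g → adjacentIn? N g y →-dec Sum.≡-dec _≟_ _≟_ g f)

    twoFactorization : (∀ x → PartitionsEdgesAt x (neighbourhood x)) →
                       TwoFactorization v m n α β E
    twoFactorization local = record
      { mFactor = mF
      ; nFactor = nF
      ; sound   = λ f x y e → proj₁ (local x) f y (FamEdge⇒AdjacentIn f e)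
      ; unique  = λ x y xy →
          let (f , a , u) = proj₂ (local x) y xy
          in f , AdjacentIn⇒FamEdge f a , λ g e → u g (FamEdge⇒AdjacentIn g e)
      }

Vertex : Set
Vertex = Fin 8 × Fin 3

embed : Vertex → Fin 24
embed = uncurry combine

shift : Fin 3 → Vertex → Vertex
shift s (b , t) = b , (toℕ s + toℕ t) mod 3

partner : Fin 8 → Fin 8
partner = lookup (# 1 ∷ # 0 ∷ # 3 ∷ # 2 ∷ # 5 ∷ # 4 ∷ # 7 ∷ # 6 ∷ [])

mate : Fin 24 → Fin 24
mate x = let (b , t) = remQuot 3 x in combine (partner b) t

matching : OneFactor 24
matching = record
  { mate    = mate
  ; involut = toWitness {a? = all? λ x → mate (mate x) ≟ x} _
  ; nofix   = toWitness {a? = all? λ x → ¬? (mate x ≟ x)} _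
  }

triangles : Vec (Vec (Vec Vertex 3) 8) 3
triangles =
  ( ((# 0 , # 0) ∷ (# 4 , # 2) ∷ (# 4 , # 1) ∷ []) ∷ ((# 0 , # 1) ∷ (# 7 , # 1) ∷ (# 1 , # 2) ∷ []) ∷
    ((# 0 , # 2) ∷ (# 6 , # 0) ∷ (# 6 , # 2) ∷ []) ∷ ((# 1 , # 0) ∷ (# 4 , # 0) ∷ (# 1 , # 1) ∷ []) ∷
    ((# 2 , # 0) ∷ (# 7 , # 2) ∷ (# 5 , # 1) ∷ []) ∷ ((# 2 , # 1) ∷ (# 5 , # 0) ∷ (# 6 , # 1) ∷ []) ∷
    ((# 2 , # 2) ∷ (# 3 , # 0) ∷ (# 7 , # 0) ∷ []) ∷ ((# 3 , # 1) ∷ (# 5 , # 2) ∷ (# 3 , # 2) ∷ []) ∷ []) ∷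
  ( ((# 0 , # 0) ∷ (# 3 , # 0) ∷ (# 1 , # 2) ∷ []) ∷ ((# 0 , # 1) ∷ (# 7 , # 0) ∷ (# 7 , # 2) ∷ []) ∷
    ((# 0 , # 2) ∷ (# 5 , # 0) ∷ (# 4 , # 2) ∷ []) ∷ ((# 1 , # 0) ∷ (# 6 , # 0) ∷ (# 7 , # 1) ∷ []) ∷
    ((# 1 , # 1) ∷ (# 3 , # 1) ∷ (# 2 , # 2) ∷ []) ∷ ((# 2 , # 0) ∷ (# 2 , # 1) ∷ (# 4 , # 1) ∷ []) ∷
    ((# 3 , # 2) ∷ (# 4 , # 0) ∷ (# 6 , # 2) ∷ []) ∷ ((# 5 , # 1) ∷ (# 6 , # 1) ∷ (# 5 , # 2) ∷ []) ∷ []) ∷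
  ( ((# 0 , # 0) ∷ (# 2 , # 1) ∷ (# 0 , # 2) ∷ []) ∷ ((# 0 , # 1) ∷ (# 6 , # 0) ∷ (# 3 , # 2) ∷ []) ∷
    ((# 1 , # 0) ∷ (# 7 , # 0) ∷ (# 5 , # 1) ∷ []) ∷ ((# 1 , # 1) ∷ (# 6 , # 2) ∷ (# 2 , # 0) ∷ []) ∷
    ((# 1 , # 2) ∷ (# 6 , # 1) ∷ (# 4 , # 0) ∷ []) ∷ ((# 2 , # 2) ∷ (# 7 , # 2) ∷ (# 5 , # 2) ∷ []) ∷
    ((# 3 , # 0) ∷ (# 4 , # 2) ∷ (# 7 , # 1) ∷ []) ∷ ((# 3 , # 1) ∷ (# 4 , # 1) ∷ (# 5 , # 0) ∷ []) ∷ []) ∷ []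

squares : Vec (Vec (Vec Vertex 4) 2) 2
squares =
  ( ((# 0 , # 0) ∷ (# 2 , # 0) ∷ (# 1 , # 0) ∷ (# 5 , # 2) ∷ []) ∷
    ((# 3 , # 0) ∷ (# 7 , # 2) ∷ (# 4 , # 2) ∷ (# 6 , # 2) ∷ []) ∷ []) ∷
  ( ((# 0 , # 0) ∷ (# 5 , # 0) ∷ (# 1 , # 0) ∷ (# 3 , # 2) ∷ []) ∷
    ((# 2 , # 0) ∷ (# 4 , # 2) ∷ (# 7 , # 0) ∷ (# 6 , # 1) ∷ []) ∷ []) ∷ []

trianglePos : Fin 9 → Fin 8 × Fin 3 → Fin 24
trianglePos a (c , i) = let (j , s) = remQuot 3 a in
  embed (shift s (lookup (lookup (lookup triangles j) c) i))

squarePos : Fin 2 → Fin 6 × Fin 4 → Fin 24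
squarePos a (c , i) = let (j , s) = remQuot 3 c in
  embed (shift s (lookup (lookup (lookup squares a) j) i))

trianglePos-injective : ∀ a p q → trianglePos a p ≡ trianglePos a q → p ≡ q
trianglePos-injective = toWitness {a? = all? λ a → injective? (trianglePos a)} _

trianglePos-surjective : ∀ a y → ∃ λ p → trianglePos a p ≡ y
trianglePos-surjective = toWitness {a? = all? λ a → all? (preimage? (trianglePos a))} _

squarePos-injective : ∀ a p q → squarePos a p ≡ squarePos a q → p ≡ q
squarePos-injective = toWitness {a? = all? λ a → injective? (squarePos a)} _

squarePos-surjective : ∀ a y → ∃ λ p → squarePos a p ≡ y
squarePos-surjective = toWitness {a? = all? λ a → all? (preimage? (squarePos a))} _

triangleFactor : Fin 9 → CFactor 24 3
triangleFactor a = cycleFactor (s≤s (s≤s (s≤s z≤n))) (trianglePos a)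
  (trianglePos-injective a) (trianglePos-surjective a)

squareFactor : Fin 2 → CFactor 24 4
squareFactor a = cycleFactor (s≤s (s≤s (s≤s z≤n))) (squarePos a)
  (squarePos-injective a) (squarePos-surjective a)

matchingComplement? : ∀ x y → Dec (KminusIEdge matching x y)
matchingComplement? x y = ¬? (x ≟ y) ×-dec ¬? (y ≟ mate x)

lemma3p1 : HWP 24 3 4 9 2
lemma3p1 =
  inj₂ (refl , matching , twoFactorization triangleFactor squareFactor matchingComplement?
    (toWitness {a? = all? λ x → partitionsEdgesAt? triangleFactor squareFactor
                                  matchingComplement? x
                                  (neighbourhood triangleFactor squareFactor x)} _))
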